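{- Let $n \geq 3$ and let $v \in A_n$ with canonical presentation $v = v_3 \cdots v_n$ (where $v_i \in R_i$). Define $\hat{\ell}(v) = \#\{ i \mid v_i \neq e\}$. Then $\hat{\ell}(v) = \ell_{T(A_n)}(v)$.
   Context: $A_n$ is the alternating group on $\{1,\dots,n\}$, with composition as the group operation, and $e$ is the identity permutation. For $m \le n$, $A_m$ is identified with the subgroup of $A_n$ fixing $m+1,\dots,n$. Set $T(A_n) = \{a_{ij} = (1\,2)(i\,j) \mid 1 \le i < j \le n\}$, which generates $A_n$. The length of $v \in A_n$ is $$\ell_{T(A_n)}(v) = \min\{k \geq 0 \mid v = b_1 \cdots b_k,\ b_i \in T(A_n)\}.$$ For $k \geq 3$, let $R_k = \{(1\,2)(j\,k) \mid 1 \le j < k\} \cup \{e\}$. Every $v \in A_n$ ($n \geq 3$) can be written uniquely as $v = v_3 v_4 \cdots v_n$ with $v_i \in R_i$. This factorization is called the canonical presentation of $v$. -}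

module Defs where

open import Data.Nat using (ℕ; zero; suc; _≤_; _≤?_; _*_)
open import Data.Fin using (Fin; zero; suc; toℕ; _<_)
open import Data.Fin.Properties using (all?) renaming (_≟_ to _≟ᶠ_)
open import Data.List using (List; []; _∷_; length; map; filter; allFin)
open import Data.List.Relation.Unary.All using (All)
open import Data.Product using (Σ; ∃; ∃-syntax; _×_; _,_)
open import Data.Sum using (_⊎_)
open import Function using (_∘_; id)
open import Relation.Nullary using (¬_; Dec; yes; no; ¬?)

open import Relation.Binary.PropositionalEquality using (_≡_)

-- Points {1,…,n} are represented by Fin n (paper point p ↔ index p-1).
-- Maps Fin n → Fin n; all permutations considered arise as products of
-- transpositions, hence are bijections.
Perm : ℕ → Set
Perm n = Fin n → Fin n

_·_ : ∀ {n} → Perm n → Perm n → Perm n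
σ · τ = σ ∘ τ

e : ∀ {n} → Perm n
e = id

_≈_ : ∀ {n} → Perm n → Perm n → Set
σ ≈ τ = ∀ x → σ x ≡ τ x

swap : ∀ {n} → Fin n → Fin n → Perm n
swap i j x with x ≟ᶠ i
... | yes _ = j
... | no _ with x ≟ᶠ j
...   | yes _ = i
...   | no _ = x

s12 : ∀ {n} → Perm n
s12 {suc (suc m)} zero = suc zero
s12 {suc (suc m)} (suc zero) = zero
s12 x = x

prod : ∀ {n} → List (Perm n) → Perm n
prod [] = e
prod (σ ∷ w) = σ · prod w

IsTransposition : ∀ {n} → Perm n → Set
IsTransposition {n} σ = Σ (Fin n) λ i → Σ (Fin n) λ j → ¬ (i ≡ j) × σ ≈ swap i j

InA : ∀ {n} → Perm n → Set
InA {n} v = Σ (List (Perm n)) λ ts →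
  All IsTransposition ts × (Σ ℕ λ k → length ts ≡ 2 * k) × v ≈ prod ts

a : ∀ {n} → Fin n → Fin n → Perm n
a i j = s12 · swap i j

InT : ∀ {n} → Perm n → Set
InT {n} σ = Σ (Fin n) λ i → Σ (Fin n) λ j → i < j × σ ≈ a i j

IsTLength : ∀ {n} → Perm n → ℕ → Set
IsTLength {n} v k =
  (Σ (List (Perm n)) λ w → All InT w × length w ≡ k × v ≈ prod w)
  × (∀ (w : List (Perm n)) → All InT w → v ≈ prod w → k ≤ length w)

InR : ∀ {n} → Fin n → Perm n → Set
InR {n} k σ = σ ≈ e ⊎ (Σ (Fin n) λ j → j < k × σ ≈ a j k)

idx : ∀ n → List (Fin n)
idx n = filter (λ k → 2 ≤? toℕ k) (allFin n)

canonProd : ∀ {n} → (Fin n → Perm n) → Perm n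
canonProd {n} vs = prod (map vs (idx n))

isId? : ∀ {n} → (σ : Perm n) → Dec (σ ≈ e)
isId? σ = all? (λ x → σ x ≟ᶠ x)

lhat : ∀ {n} → (Fin n → Perm n) → ℕ
lhat {n} vs = length (filter (λ k → ¬? (isId? (vs k))) (idx n))

module Submission where

open import Defs
open import Data.Bool using (Bool; true; false; not)
open import Data.Nat using (ℕ; zero; suc; _+_; _≤_; _<_; _≤?_; z≤n; s≤s)
open import Data.Nat.Properties
  using (≤-refl; ≤-trans; ≤-reflexive; <-trans; n≤1+n; +-suc; +-identityʳ; +-monoʳ-≤; module ≤-Reasoning)
open import Data.Fin using (Fin; zero; suc; toℕ)
import Data.Fin as Fin
open import Data.Fin.Properties using () renaming (_≟_ to _≟ᶠ_; <⇒≢ to <⇒≢ᶠ)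
open import Data.List using (List; []; _∷_; length; map; filter; reverse; allFin; _∷ʳ_; [_])
open import Data.List.Properties using (filter-accept; filter-reject; unfold-reverse; map-++; reverse-involutive)
open import Data.List.Relation.Binary.Permutation.Propositional using (↭-sym)
open import Data.List.Relation.Binary.Permutation.Propositional.Properties
  using (↭-reverse; ↭-length; filter-↭; All-resp-↭)
open import Data.Product using (Σ; ∃-syntax; _×_; _,_; proj₁; proj₂)
open import Data.Sum using (inj₁; inj₂)
open import Data.List.Relation.Unary.All using (All; []; _∷_)
open import Data.List.Relation.Unary.AllPairs using (AllPairs; []; _∷_)
import Data.List.Relation.Unary.All as All
open import Data.List.Relation.Unary.All.Properties using (all-filter)
import Data.List.Relation.Unary.AllPairs.Properties as AllPairs
open import Data.Empty using (⊥-elim)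
open import Function using (_∘_; flip; id)
open import Relation.Nullary using (¬_; yes; no; ¬?)
open import Relation.Binary.PropositionalEquality
  using (_≡_; _≢_; refl; sym; trans; cong; cong₂; subst; module ≡-Reasoning)

-- The lengths of transposition words are controlled by a greedy sorting measure.
-- sortCost qs σ walks through the points qs in order and, whenever σ moves the
-- current point q, left-multiplies σ by the transposition (σ q  q) and counts one.
-- (1) Left multiplication by any transposition raises sortCost by at most one.
-- (2) Consequently, if v = b₁ ⋯ b_k with b_i = (1 2)(i j) ∈ T(A_n), then
--     sortCost qs (z · v⁻¹) ≤ k for z = e or z = (1 2): multiplying v⁻¹ by
--     b⁻¹ = (i j)(1 2) costs one transposition once the (1 2) is absorbed into z.
-- (3) For the canonical presentation v = v₃ ⋯ v_n, sorting z · v⁻¹ at the points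
--     n, n-1, …, 3 uses exactly one transposition per nontrivial factor v_k,
--     for both choices of z; hence ℓ̂(v) ≤ k for every T-word of length k.
-- (4) Deleting the trivial factors of v₃ ⋯ v_n gives a T-word of length ℓ̂(v).
-- Together (3) and (4) say that ℓ̂(v) is the T-length of v.

private
  variable
    n : ℕ

Injective : Perm n → Set
Injective t = ∀ {x y} → t x ≡ t y → x ≡ y

data SwapView {n} (i j x : Fin n) : Fin n → Set where
  at-i  : x ≡ i → SwapView i j x j
  at-j  : x ≢ i → x ≡ j → SwapView i j x i
  other : x ≢ i → x ≢ j → SwapView i j x x

swap-view : (i j x : Fin n) → SwapView i j x (swap i j x)
swap-view i j x with x ≟ᶠ i
... | yes x≡i = at-i x≡i
... | no x≢i with x ≟ᶠ j
...   | yes x≡j = at-j x≢i x≡j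
...   | no x≢j = other x≢i x≢j

swap-left : (i j : Fin n) → swap i j i ≡ j
swap-left i j with swap i j i | swap-view i j i
... | _ | at-i _ = refl
... | _ | at-j i≢i _ = ⊥-elim (i≢i refl)
... | _ | other i≢i _ = ⊥-elim (i≢i refl)

swap-right : (i j : Fin n) → swap i j j ≡ i
swap-right i j with swap i j j | swap-view i j j
... | _ | at-i j≡i = j≡i
... | _ | at-j _ _ = refl
... | _ | other _ j≢j = ⊥-elim (j≢j refl)

swap-fixes : {i j x : Fin n} → x ≢ i → x ≢ j → swap i j x ≡ x
swap-fixes {i = i} {j} {x} x≢i x≢j with swap i j x | swap-view i j x
... | _ | at-i x≡i = ⊥-elim (x≢i x≡i)
... | _ | at-j _ x≡j = ⊥-elim (x≢j x≡j)
... | _ | other _ _ = refl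

swap-involutive : (i j x : Fin n) → swap i j (swap i j x) ≡ x
swap-involutive i j x with swap i j x | swap-view i j x
... | _ | at-i refl = swap-right i j
... | _ | at-j _ refl = swap-left i j
... | _ | other x≢i x≢j = swap-fixes x≢i x≢j

swap-injective : (i j : Fin n) → Injective (swap i j)
swap-injective i j {x} {y} eq =
  trans (sym (swap-involutive i j x)) (trans (cong (swap i j) eq) (swap-involutive i j y))

swap-symmetric : (i j x : Fin n) → swap i j x ≡ swap j i x
swap-symmetric i j x with swap i j x | swap-view i j x
... | _ | at-i refl = sym (swap-right j x)
... | _ | at-j _ refl = sym (swap-left x i)
... | _ | other x≢i x≢j = sym (swap-fixes x≢j x≢i)

swap-conjugate : (t : Perm n) → Injective t → (i j x : Fin n) →
  t (swap i j x) ≡ swap (t i) (t j) (t x)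
swap-conjugate t t-inj i j x with swap i j x | swap-view i j x
... | _ | at-i refl = sym (swap-left (t x) (t j))
... | _ | at-j _ refl = sym (swap-right (t i) (t x))
... | _ | other x≢i x≢j =
  sym (swap-fixes (λ tx≡ti → x≢i (t-inj tx≡ti)) (λ tx≡tj → x≢j (t-inj tx≡tj)))

swap-conjugate-fixed : (t : Perm n) → Injective t → {q : Fin n} → t q ≡ q → (p w : Fin n) →
  t (swap p q w) ≡ swap (t p) q (t w)
swap-conjugate-fixed t t-inj {q} tq≡q p w =
  trans (swap-conjugate t t-inj p q w) (cong (λ r → swap (t p) r (t w)) tq≡q)

swap-reorder : {j q z : Fin n} → z ≢ j → z ≢ q → (w : Fin n) →
  swap j q (swap z q w) ≡ swap z j (swap j q w)
swap-reorder {j = j} {q} {z} z≢j z≢q w =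
  trans (swap-conjugate (swap j q) (swap-injective j q) z q w)
        (cong₂ (λ p r → swap p r (swap j q w)) (swap-fixes z≢j z≢q) (swap-right j q))

swap-through : (x y q : Fin n) → swap x y q ≢ q → (w : Fin n) → swap x y w ≡ swap (swap x y q) q w
swap-through x y q moved w with swap x y q | swap-view x y q
... | _ | at-i refl = swap-symmetric q y w
... | _ | at-j _ refl = refl
... | _ | other _ _ = ⊥-elim (moved refl)

s12-involutive : (x : Fin n) → s12 (s12 x) ≡ x
s12-involutive {suc (suc _)} zero = refl
s12-involutive {suc (suc _)} (suc zero) = refl
s12-involutive {suc (suc _)} (suc (suc x)) = refl
s12-involutive {suc zero} zero = refl

s12-fixes : (x : Fin n) → 2 ≤ toℕ x → s12 x ≡ x
s12-fixes {suc (suc _)} (suc (suc x)) _ = refl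
s12-fixes {suc (suc _)} (suc zero) (s≤s ())
s12-fixes {suc zero} zero ()

s12-below : (j k : Fin n) → toℕ j < toℕ k → 2 ≤ toℕ k → toℕ (s12 j) < toℕ k
s12-below {suc (suc _)} zero k _ 2≤k = 2≤k
s12-below {suc (suc _)} (suc zero) k _ 2≤k = ≤-trans (s≤s z≤n) 2≤k
s12-below {suc (suc _)} (suc (suc j)) k j<k _ = j<k
s12-below {suc zero} zero k j<k _ = j<k

-- Elements of T(A_n) are (1 2)(i j), so words in T are words in transpositions
-- up to a twist; the lemmas below transfer the properties of (1 2) to it.
twist : Bool → Perm n
twist false = e
twist true = s12

twist-injective : (b : Bool) → Injective (twist {n} b)
twist-injective false eq = eq
twist-injective true {x} {y} eq =
  trans (sym (s12-involutive x)) (trans (cong s12 eq) (s12-involutive y))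

twist-fixes : (b : Bool) (x : Fin n) → 2 ≤ toℕ x → twist b x ≡ x
twist-fixes false x _ = refl
twist-fixes true x 2≤x = s12-fixes x 2≤x

twist-below : (b : Bool) (j k : Fin n) → toℕ j < toℕ k → 2 ≤ toℕ k → toℕ (twist b j) < toℕ k
twist-below false j k j<k _ = j<k
twist-below true j k j<k 2≤k = s12-below j k j<k 2≤k

twist-s12 : (b : Bool) (x : Fin n) → twist b (s12 x) ≡ twist (not b) x
twist-s12 false x = refl
twist-s12 true x = s12-involutive x

sortCost : List (Fin n) → Perm n → ℕ
sortCost [] σ = 0
sortCost (q ∷ qs) σ with σ q ≟ᶠ q
... | yes _ = sortCost qs σ
... | no _ = suc (sortCost qs (swap (σ q) q · σ))

sortCost-fixed : (q : Fin n) (qs : List (Fin n)) (σ : Perm n) → σ q ≡ q →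
  sortCost (q ∷ qs) σ ≡ sortCost qs σ
sortCost-fixed q qs σ fixed with σ q ≟ᶠ q
... | yes _ = refl
... | no moved = ⊥-elim (moved fixed)

sortCost-moved : (q : Fin n) (qs : List (Fin n)) (σ : Perm n) → σ q ≢ q →
  sortCost (q ∷ qs) σ ≡ suc (sortCost qs (swap (σ q) q · σ))
sortCost-moved q qs σ moved with σ q ≟ᶠ q
... | yes fixed = ⊥-elim (moved fixed)
... | no _ = refl

sortCost-cong : (qs : List (Fin n)) {σ τ : Perm n} → σ ≈ τ → sortCost qs σ ≡ sortCost qs τ
sortCost-cong [] σ≈τ = refl
sortCost-cong (q ∷ qs) {σ} {τ} σ≈τ with σ q ≟ᶠ q
... | yes fixed = trans (sortCost-cong qs σ≈τ) (sym (sortCost-fixed q qs τ (trans (sym (σ≈τ q)) fixed)))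
... | no moved = trans (cong suc (sortCost-cong qs λ w → cong₂ (λ p r → swap p q r) (σ≈τ q) (σ≈τ w)))
                       (sym (sortCost-moved q qs τ λ fixed → moved (trans (σ≈τ q) fixed)))

sortCost-identity : (qs : List (Fin n)) → sortCost qs e ≡ 0
sortCost-identity [] = refl
sortCost-identity (q ∷ qs) = trans (sortCost-fixed q qs e refl) (sortCost-identity qs)

SwapBounded : List (Fin n) → Set
SwapBounded {n} qs = (x y : Fin n) (σ : Perm n) → sortCost qs (swap x y · σ) ≤ suc (sortCost qs σ)

-- Induction step when the transposition t = (x y) fixes the first point q:
-- t commutes with the greedy step at q.
sortCost-swap-fixing : (q : Fin n) (qs : List (Fin n)) → SwapBounded qs →
  (x y : Fin n) (σ : Perm n) → swap x y q ≡ q →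
  sortCost (q ∷ qs) (swap x y · σ) ≤ suc (sortCost (q ∷ qs) σ)
sortCost-swap-fixing {n} q qs bounded x y σ tq≡q with σ q ≟ᶠ q
... | yes σq≡q = begin
  sortCost (q ∷ qs) (t · σ) ≡⟨ sortCost-fixed q qs (t · σ) (trans (cong t σq≡q) tq≡q) ⟩
  sortCost qs (t · σ)       ≤⟨ bounded x y σ ⟩
  suc (sortCost qs σ)       ∎
  where
  open ≤-Reasoning
  t : Perm n
  t = swap x y
... | no σq≢q = begin
  sortCost (q ∷ qs) (t · σ)                        ≡⟨ sortCost-moved q qs (t · σ) tσq≢q ⟩
  suc (sortCost qs (swap (t (σ q)) q · (t · σ)))   ≡⟨ cong suc (sortCost-cong qs commute) ⟩
  suc (sortCost qs (t · (swap (σ q) q · σ)))       ≤⟨ s≤s (bounded x y (swap (σ q) q · σ)) ⟩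
  suc (suc (sortCost qs (swap (σ q) q · σ)))       ∎
  where
  open ≤-Reasoning
  t : Perm n
  t = swap x y
  tσq≢q : t (σ q) ≢ q
  tσq≢q tσq≡q = σq≢q (swap-injective x y (trans tσq≡q (sym tq≡q)))
  commute : (swap (t (σ q)) q · (t · σ)) ≈ (t · (swap (σ q) q · σ))
  commute w = sym (swap-conjugate-fixed t (swap-injective x y) tq≡q (σ q) (σ w))

sortCost-swap-moving : (q : Fin n) (qs : List (Fin n)) → SwapBounded qs →
  (z : Fin n) (σ : Perm n) → z ≢ q →
  sortCost (q ∷ qs) (swap z q · σ) ≤ suc (sortCost (q ∷ qs) σ)
sortCost-swap-moving {n} q qs bounded z σ z≢q with σ q ≟ᶠ q
... | yes σq≡q = ≤-reflexive (begin
  sortCost (q ∷ qs) (t · σ)                 ≡⟨ sortCost-moved q qs (t · σ) tσq≢q ⟩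
  suc (sortCost qs (swap (t (σ q)) q · (t · σ))) ≡⟨ cong suc (sortCost-cong qs cancel) ⟩
  suc (sortCost qs σ)                        ∎)
  where
  open ≡-Reasoning
  t : Perm n
  t = swap z q
  tσq≡z : t (σ q) ≡ z
  tσq≡z = trans (cong t σq≡q) (swap-right z q)
  tσq≢q : t (σ q) ≢ q
  tσq≢q tσq≡q = z≢q (trans (sym tσq≡z) tσq≡q)
  cancel : (swap (t (σ q)) q · (t · σ)) ≈ σ
  cancel w = trans (cong (λ p → swap p q (t (σ w))) tσq≡z) (swap-involutive z q (σ w))
... | no σq≢q with z ≟ᶠ σ q
...   | yes z≡σq = begin
  sortCost (q ∷ qs) (t · σ)           ≡⟨ sortCost-fixed q qs (t · σ) (trans (cong t (sym z≡σq)) (swap-left z q)) ⟩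
  sortCost qs (t · σ)                 ≡⟨ sortCost-cong qs (λ w → cong (λ p → swap p q (σ w)) z≡σq) ⟩
  sortCost qs (swap (σ q) q · σ)      ≤⟨ n≤1+n _ ⟩
  suc (sortCost qs (swap (σ q) q · σ)) ≤⟨ n≤1+n _ ⟩
  suc (suc (sortCost qs (swap (σ q) q · σ))) ∎
  where
  open ≤-Reasoning
  t : Perm n
  t = swap z q
...   | no z≢σq = begin
  sortCost (q ∷ qs) (t · σ)                       ≡⟨ sortCost-moved q qs (t · σ) tσq≢q ⟩
  suc (sortCost qs (swap (t j) q · (t · σ)))      ≡⟨ cong suc (sortCost-cong qs reorder) ⟩
  suc (sortCost qs (swap z j · (swap j q · σ)))   ≤⟨ s≤s (bounded z j (swap j q · σ)) ⟩
  suc (suc (sortCost qs (swap j q · σ)))          ∎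
  where
  open ≤-Reasoning
  t : Perm n
  t = swap z q
  j : Fin n
  j = σ q
  tj≡j : t j ≡ j
  tj≡j = swap-fixes (λ σq≡z → z≢σq (sym σq≡z)) σq≢q
  tσq≢q : t (σ q) ≢ q
  tσq≢q tj≡q = σq≢q (trans (sym tj≡j) tj≡q)
  reorder : (swap (t j) q · (t · σ)) ≈ (swap z j · (swap j q · σ))
  reorder w = trans (cong (λ p → swap p q (t (σ w))) tj≡j)
                    (swap-reorder z≢σq z≢q (σ w))

sortCost-swap : (qs : List (Fin n)) → SwapBounded qs
sortCost-swap [] x y σ = z≤n
sortCost-swap (q ∷ qs) x y σ with swap x y q ≟ᶠ q
... | yes tq≡q = sortCost-swap-fixing q qs (sortCost-swap qs) x y σ tq≡q
... | no tq≢q = subst (_≤ suc (sortCost (q ∷ qs) σ))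
  (sortCost-cong (q ∷ qs) (λ w → sym (swap-through x y q tq≢q (σ w))))
  (sortCost-swap-moving q qs (sortCost-swap qs) (swap x y q) σ tq≢q)

generatorInverse : {b : Perm n} → InT b → Perm n
generatorInverse (i , j , _ , _) = swap i j · s12

generatorInverse-right : {b : Perm n} (t : InT b) (y : Fin n) → b (generatorInverse t y) ≡ y
generatorInverse-right {b = b} (i , j , _ , b≈a) y =
  trans (b≈a _) (trans (cong s12 (swap-involutive i j (s12 y))) (s12-involutive y))

-- Left multiplication by (i j)(1 2) costs one transposition, once the factor
-- (1 2) is moved into the twist: (1 2)(i j)(1 2) = (s12 i  s12 j).
sortCost-generatorInverse : (qs : List (Fin n)) {b : Perm n} (t : InT b) (c : Bool) (σ : Perm n) →
  sortCost qs (twist (not c) · (generatorInverse t · σ)) ≤ suc (sortCost qs (twist c · σ))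
sortCost-generatorInverse qs (i , j , _ , _) false σ =
  subst (_≤ suc (sortCost qs σ))
    (sortCost-cong qs λ w → sym (trans (swap-conjugate s12 (twist-injective true) i j (s12 (σ w)))
                                      (cong (swap (s12 i) (s12 j)) (s12-involutive (σ w)))))
    (sortCost-swap qs (s12 i) (s12 j) σ)
sortCost-generatorInverse qs (i , j , _ , _) true σ = sortCost-swap qs i j (s12 · σ)

wordInverse : (w : List (Perm n)) → All InT w → Perm n
wordInverse [] [] = e
wordInverse (_ ∷ w) (t ∷ ts) = wordInverse w ts · generatorInverse t

wordInverse-right : (w : List (Perm n)) (ts : All InT w) (y : Fin n) → prod w (wordInverse w ts y) ≡ y
wordInverse-right [] [] y = refl
wordInverse-right (b ∷ w) (t ∷ ts) y =
  trans (cong b (wordInverse-right w ts (generatorInverse t y))) (generatorInverse-right t y)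

sortCost-wordInverse : (qs : List (Fin n)) (w : List (Perm n)) (ts : All InT w) (c : Bool) (σ : Perm n) →
  ∃[ c′ ] sortCost qs (twist c′ · (wordInverse w ts · σ)) ≤ length w + sortCost qs (twist c · σ)
sortCost-wordInverse qs [] [] c σ = c , ≤-refl
sortCost-wordInverse qs (_ ∷ w) (t ∷ ts) c σ
  with sortCost-wordInverse qs w ts (not c) (generatorInverse t · σ)
... | c′ , bound = c′ , (begin
  sortCost qs (twist c′ · (wordInverse w ts · (generatorInverse t · σ)))
    ≤⟨ bound ⟩
  length w + sortCost qs (twist (not c) · (generatorInverse t · σ))
    ≤⟨ +-monoʳ-≤ (length w) (sortCost-generatorInverse qs t c σ) ⟩
  length w + suc (sortCost qs (twist c · σ))
    ≡⟨ +-suc (length w) _ ⟩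
  suc (length w + sortCost qs (twist c · σ)) ∎)
  where open ≤-Reasoning

prod-∷ʳ : (ws : List (Perm n)) (σ : Perm n) (y : Fin n) → prod (ws ∷ʳ σ) y ≡ prod ws (σ y)
prod-∷ʳ [] σ y = refl
prod-∷ʳ (τ ∷ ws) σ y = cong τ (prod-∷ʳ ws σ y)

inverses-agree : {μ ρ σ : Perm n} → (∀ y → μ (σ y) ≡ y) → (∀ y → σ (ρ y) ≡ y) → μ ≈ ρ
inverses-agree {μ = μ} {ρ} left right y = trans (cong μ (sym (right y))) (left (ρ y))

prod-reverse-∷ : {A : Set} (f : A → Perm n) (d : A) (ds : List A) (y : Fin n) →
  prod (map f (reverse (d ∷ ds))) y ≡ prod (map f (reverse ds)) (f d y)
prod-reverse-∷ f d ds y = begin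
  prod (map f (reverse (d ∷ ds))) y   ≡⟨ cong (λ ks → prod (map f ks) y) (unfold-reverse d ds) ⟩
  prod (map f (reverse ds ∷ʳ d)) y    ≡⟨ cong (λ ws → prod ws y) (map-++ f (reverse ds) [ d ]) ⟩
  prod (map f (reverse ds) ∷ʳ f d) y  ≡⟨ prod-∷ʳ (map f (reverse ds)) (f d) y ⟩
  prod (map f (reverse ds)) (f d y)   ∎
  where open ≡-Reasoning

all-reverse : {A : Set} {P : A → Set} {xs : List A} → All P xs → All P (reverse xs)
all-reverse {xs = xs} = All-resp-↭ (↭-sym (↭-reverse xs))

allPairs-reverse : {A : Set} {R : A → A → Set} {xs : List A} → AllPairs R xs → AllPairs (flip R) (reverse xs)
allPairs-reverse {xs = []} [] = []
allPairs-reverse {R = R} {xs = x ∷ xs} (x~xs ∷ sorted) =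
  subst (AllPairs (flip R)) (sym (unfold-reverse x xs))
    (AllPairs.++⁺ (allPairs-reverse sorted) ([] ∷ []) (All.map (_∷ []) (all-reverse x~xs)))

factor-generator : {k : Fin n} {σ : Perm n} → InR k σ → ¬ σ ≈ e → InT σ
factor-generator (inj₁ trivial) nontrivial = ⊥-elim (nontrivial trivial)
factor-generator {k = k} (inj₂ (j , j<k , σ≈a)) _ = j , k , j<k , σ≈a

module CanonicalFactors {n : ℕ} (vs : Fin n → Perm n) where

  count : List (Fin n) → ℕ
  count ks = length (filter (λ k → ¬? (isId? (vs k))) ks)

  count-trivial : {k : Fin n} (ks : List (Fin n)) → vs k ≈ e → count (k ∷ ks) ≡ count ks
  count-trivial ks trivial = cong length (filter-reject (λ k → ¬? (isId? (vs k))) (λ nontrivial → nontrivial trivial))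

  count-nontrivial : {k : Fin n} (ks : List (Fin n)) → ¬ vs k ≈ e → count (k ∷ ks) ≡ suc (count ks)
  count-nontrivial ks nontrivial = cong length (filter-accept (λ k → ¬? (isId? (vs k))) nontrivial)

  count-reverse : (ks : List (Fin n)) → count (reverse ks) ≡ count ks
  count-reverse ks = ↭-length (filter-↭ (λ k → ¬? (isId? (vs k))) (↭-reverse ks))

  Canonical : List (Fin n) → Set
  Canonical = All (λ k → InR k (vs k))

  factorInverse : {k : Fin n} {σ : Perm n} → InR k σ → Perm n
  factorInverse (inj₁ _) = e
  factorInverse {k} (inj₂ (j , _ , _)) = swap j k · s12

  factorInverse-left : {k : Fin n} {σ : Perm n} (r : InR k σ) (y : Fin n) → factorInverse r (σ y) ≡ y
  factorInverse-left (inj₁ σ≈e) y = σ≈e y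
  factorInverse-left {k} (inj₂ (j , _ , σ≈a)) y =
    trans (cong (swap j k ∘ s12) (σ≈a y))
          (trans (cong (swap j k) (s12-involutive (swap j k y))) (swap-involutive j k y))

  inverseProduct : (ds : List (Fin n)) → Canonical ds → Perm n
  inverseProduct [] [] = e
  inverseProduct (d ∷ ds) (r ∷ rs) = factorInverse r · inverseProduct ds rs

  inverseProduct-left : (ds : List (Fin n)) (rs : Canonical ds) (y : Fin n) →
    inverseProduct ds rs (prod (map vs (reverse ds)) y) ≡ y
  inverseProduct-left [] [] y = refl
  inverseProduct-left (d ∷ ds) (r ∷ rs) y = begin
    factorInverse r (inverseProduct ds rs (prod (map vs (reverse (d ∷ ds))) y))
      ≡⟨ cong (factorInverse r ∘ inverseProduct ds rs) (prod-reverse-∷ vs d ds y) ⟩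
    factorInverse r (inverseProduct ds rs (prod (map vs (reverse ds)) (vs d y)))
      ≡⟨ cong (factorInverse r) (inverseProduct-left ds rs (vs d y)) ⟩
    factorInverse r (vs d y)
      ≡⟨ factorInverse-left r y ⟩
    y ∎
    where open ≡-Reasoning

  inverseProduct-fixes : (ds : List (Fin n)) (rs : Canonical ds) (x : Fin n) →
    All (Fin._< x) ds → 2 ≤ toℕ x → inverseProduct ds rs x ≡ x
  inverseProduct-fixes [] [] x [] _ = refl
  inverseProduct-fixes (d ∷ ds) (inj₁ _ ∷ rs) x (_ ∷ ds<x) 2≤x = inverseProduct-fixes ds rs x ds<x 2≤x
  inverseProduct-fixes (d ∷ ds) (inj₂ (j , j<d , _) ∷ rs) x (d<x ∷ ds<x) 2≤x = begin
    swap j d (s12 (inverseProduct ds rs x)) ≡⟨ cong (swap j d ∘ s12) (inverseProduct-fixes ds rs x ds<x 2≤x) ⟩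
    swap j d (s12 x)                         ≡⟨ cong (swap j d) (s12-fixes x 2≤x) ⟩
    swap j d x                               ≡⟨ swap-fixes (λ x≡j → <⇒≢ᶠ (<-trans j<d d<x) (sym x≡j))
                                                           (λ x≡d → <⇒≢ᶠ d<x (sym x≡d)) ⟩
    x ∎
    where open ≡-Reasoning

  -- Sorting z · (v_{d₁}⁻¹ v_{d₂}⁻¹ ⋯) at d₁ > d₂ > ⋯ ≥ 3, for z ∈ {e, (1 2)}, uses
  -- exactly one transposition per nontrivial factor: at d₁ the trivial factor
  -- leaves d₁ fixed, while (j d₁)(1 2) sends d₁ to j and sorting at d₁ cancels (j d₁),
  -- leaving only a change of twist.
  sortCost-inverseProduct : (ds : List (Fin n)) (rs : Canonical ds) →
    AllPairs Fin._>_ ds → All (λ d → 2 ≤ toℕ d) ds →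
    (c : Bool) → sortCost ds (twist c · inverseProduct ds rs) ≡ count ds
  sortCost-inverseProduct [] [] [] [] c = refl
  sortCost-inverseProduct (d ∷ ds) (inj₁ trivial ∷ rs) (d>ds ∷ descending) (2≤d ∷ above) c = begin
    sortCost (d ∷ ds) (twist c · ρ) ≡⟨ sortCost-fixed d ds (twist c · ρ) d-fixed ⟩
    sortCost ds (twist c · ρ)       ≡⟨ sortCost-inverseProduct ds rs descending above c ⟩
    count ds                        ≡⟨ sym (count-trivial ds trivial) ⟩
    count (d ∷ ds)                  ∎
    where
    open ≡-Reasoning
    ρ : Perm n
    ρ = inverseProduct ds rs
    d-fixed : twist c (ρ d) ≡ d
    d-fixed = trans (cong (twist c) (inverseProduct-fixes ds rs d d>ds 2≤d)) (twist-fixes c d 2≤d)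
  sortCost-inverseProduct (d ∷ ds) (inj₂ (j , j<d , vd≈a) ∷ rs) (d>ds ∷ descending) (2≤d ∷ above) c = begin
    sortCost (d ∷ ds) σ                    ≡⟨ sortCost-moved d ds σ σd≢d ⟩
    suc (sortCost ds (swap (σ d) d · σ))   ≡⟨ cong suc (sortCost-cong ds untwist) ⟩
    suc (sortCost ds (twist (not c) · ρ))  ≡⟨ cong suc (sortCost-inverseProduct ds rs descending above (not c)) ⟩
    suc (count ds)                         ≡⟨ sym (count-nontrivial ds nontrivial) ⟩
    count (d ∷ ds)                         ∎
    where
    open ≡-Reasoning
    ρ σ : Perm n
    ρ = inverseProduct ds rs
    σ = twist c · ((swap j d · s12) · ρ)
    ρd≡d : ρ d ≡ d
    ρd≡d = inverseProduct-fixes ds rs d d>ds 2≤d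
    σd≡cj : σ d ≡ twist c j
    σd≡cj = cong (twist c) (trans (cong (swap j d ∘ s12) ρd≡d)
                                  (trans (cong (swap j d) (s12-fixes d 2≤d)) (swap-right j d)))
    σd≢d : σ d ≢ d
    σd≢d σd≡d = <⇒≢ᶠ (twist-below c j d j<d 2≤d) (trans (sym σd≡cj) σd≡d)
    nontrivial : ¬ vs d ≈ e
    nontrivial vd≈e = <⇒≢ᶠ (s12-below j d j<d 2≤d)
      (trans (cong s12 (sym (swap-right j d))) (trans (sym (vd≈a d)) (vd≈e d)))
    -- (c j  d) · twist c · (j d) = twist c, since twist c fixes d
    untwist : (swap (σ d) d · σ) ≈ (twist (not c) · ρ)
    untwist w = begin
      swap (σ d) d (twist c (swap j d (s12 (ρ w))))
        ≡⟨ cong (λ p → swap p d (twist c (swap j d (s12 (ρ w))))) σd≡cj ⟩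
      swap (twist c j) d (twist c (swap j d (s12 (ρ w))))
        ≡⟨ sym (swap-conjugate-fixed (twist c) (twist-injective c) (twist-fixes c d 2≤d) j _) ⟩
      twist c (swap j d (swap j d (s12 (ρ w))))
        ≡⟨ cong (twist c) (swap-involutive j d (s12 (ρ w))) ⟩
      twist c (s12 (ρ w))
        ≡⟨ twist-s12 c (ρ w) ⟩
      twist (not c) (ρ w) ∎

  upper-bound : (ks : List (Fin n)) → Canonical ks →
    Σ (List (Perm n)) λ w → All InT w × length w ≡ count ks × prod (map vs ks) ≈ prod w
  upper-bound [] [] = [] , [] , refl , λ _ → refl
  upper-bound (k ∷ ks) (r ∷ rs) with upper-bound ks rs | isId? (vs k)
  ... | w , ts , len , vs≈w | yes trivial =
    w , ts , trans len (sym (count-trivial ks trivial)) , λ y → trans (trivial _) (vs≈w y)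
  ... | w , ts , len , vs≈w | no nontrivial =
    vs k ∷ w , factor-generator r nontrivial ∷ ts , trans (cong suc len) (sym (count-nontrivial ks nontrivial)) ,
    λ y → cong (vs k) (vs≈w y)

  -- Every T-word for the product of the canonical factors at k₁ < k₂ < ⋯ (all ≥ 3)
  -- has at least count ks letters: sort z · v⁻¹ at the points k_m > ⋯ > k₁.
  lower-bound : (ks : List (Fin n)) (rs : Canonical ks) →
    AllPairs Fin._<_ ks → All (λ k → 2 ≤ toℕ k) ks →
    (w : List (Perm n)) → All InT w → prod (map vs ks) ≈ prod w → count ks ≤ length w
  lower-bound ks rs increasing above w ts vs≈w = begin
    count ks                  ≡⟨ sym (count-reverse ks) ⟩
    count ds                  ≡⟨ sym (sortCost-inverseProduct ds rsᵣ (allPairs-reverse increasing) (all-reverse above) c) ⟩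
    sortCost ds (twist c · U) ≡⟨ sortCost-cong ds (λ y → cong (twist c) (U≈W y)) ⟩
    sortCost ds (twist c · W) ≤⟨ proj₂ word-cost ⟩
    length w + sortCost ds e  ≡⟨ cong (length w +_) (sortCost-identity ds) ⟩
    length w + 0              ≡⟨ +-identityʳ (length w) ⟩
    length w                  ∎
    where
    open ≤-Reasoning
    ds : List (Fin n)
    ds = reverse ks
    rsᵣ : Canonical ds
    rsᵣ = all-reverse rs
    U W : Perm n
    U = inverseProduct ds rsᵣ
    W = wordInverse w ts
    word-cost : ∃[ c ] sortCost ds (twist c · W) ≤ length w + sortCost ds e
    word-cost = sortCost-wordInverse ds w ts false e
    c : Bool
    c = proj₁ word-cost
    reversed≈w : prod (map vs (reverse ds)) ≈ prod w
    reversed≈w y = trans (cong (λ ks′ → prod (map vs ks′) y) (reverse-involutive ks)) (vs≈w y)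
    U≈W : U ≈ W
    U≈W = inverses-agree (λ y → trans (cong U (sym (reversed≈w y))) (inverseProduct-left ds rsᵣ y))
                         (wordInverse-right w ts)

open CanonicalFactors using (Canonical; upper-bound; lower-bound)

theorem4p6 : ∀ (n : ℕ) → 3 ≤ n → (v : Perm n) → InA v
    → (vs : Fin n → Perm n) → (∀ (k : Fin n) → 2 ≤ toℕ k → InR k (vs k))
    → v ≈ canonProd vs
    → IsTLength v (lhat vs)
theorem4p6 n _ v _ vs canonical v≈canon = shortest-word , every-word-longer
  where
  ks : List (Fin n)
  ks = idx n
  above : All (λ k → 2 ≤ toℕ k) ks
  above = all-filter (λ k → 2 ≤? toℕ k) (allFin n)
  increasing : AllPairs Fin._<_ ks
  increasing = AllPairs.filter⁺ (λ k → 2 ≤? toℕ k) (AllPairs.tabulate⁺-< id)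
  rs : Canonical vs ks
  rs = All.map (canonical _) above
  shortest-word : Σ (List (Perm n)) λ w → All InT w × length w ≡ lhat vs × v ≈ prod w
  shortest-word with upper-bound vs ks rs
  ... | w , ts , len , canon≈w = w , ts , len , λ y → trans (v≈canon y) (canon≈w y)
  every-word-longer : ∀ w → All InT w → v ≈ prod w → lhat vs ≤ length w
  every-word-longer w ts v≈w = lower-bound vs ks rs increasing above w ts λ y → trans (sym (v≈canon y)) (v≈w y)
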